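{- For positive integers $m<n$, the complete bipartite graph $K_{m,n}$ is a $\left(\frac{n-1}{m-1}\right)$-EQDB graph.
   Context: For a connected graph $A$, $d_A$ denotes shortest-path distance. For a vertex $x$ and an edge $f'=g'h'$, $d_A(x,f')=\min\{d_A(x,g'),d_A(x,h')\}$. For an edge $f=gh$, $m_g(f)=|\{f'\in E(A): d_A(g,f')<d_A(h,f')\}|$, and $m_h(f)$ symmetrically. For a rational $\lambda>1$, $A$ is $\lambda$-EQDB if for every edge $f=gh$ either $m_g(f)=\lambda m_h(f)$ or $m_h(f)=\lambda m_g(f)$. -}

module Defs where

open import Data.Bool using (Bool; true; false; _∧_; _∨_; not; T; if_then_else_)
open import Data.Nat using (ℕ; zero; suc; _≤_; _∸_; _<ᵇ_; _≡ᵇ_; _⊓_; NonZero; >-nonZero)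
open import Data.Nat.Properties using (∸-monoˡ-≤)
open import Data.Fin using (Fin; toℕ)
open import Data.List using (List; []; _∷_; length; filterᵇ; allFin; cartesianProduct)
open import Data.Bool.ListAction using (any)
open import Data.Product using (_×_; _,_; proj₁; proj₂)
open import Data.Rational using (ℚ)
open import Data.Rational as ℚ using ()
open import Data.Integer using (+_)
open import Relation.Binary.PropositionalEquality using (_≡_)

record Graph : Set where
  field
    V     : ℕ
    adj   : Fin V → Fin V → Bool
    sym   : ∀ x y → adj x y ≡ adj y x
    irr   : ∀ x → adj x x ≡ false
open Graph public

module _ (A : Graph) where
  private
    n = V A

  reach : ℕ → Fin n → Fin n → Bool
  reach zero    x y = toℕ x ≡ᵇ toℕ y
  reach (suc k) x y = reach k x y ∨ any (λ z → reach k x z ∧ adj A z y) (allFin n)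

  -- connected: every pair of vertices is joined by a walk (of length ≤ V-1 ≤ V)
  Connected : Set
  Connected = ∀ x y → T (reach n x y)

  private
    search : ℕ → ℕ → Fin n → Fin n → ℕ
    search zero     i x y = i
    search (suc fu) i x y = if reach i x y then i else search fu (suc i) x y

  -- shortest-path distance d_A(x,y) (correct for connected graphs,
  -- where every distance is at most V)
  dist : Fin n → Fin n → ℕ
  dist x y = search n 0 x y

  edges : List (Fin n × Fin n)
  edges = filterᵇ (λ e → (toℕ (proj₁ e) <ᵇ toℕ (proj₂ e)) ∧ adj A (proj₁ e) (proj₂ e))
                  (cartesianProduct (allFin n) (allFin n))

  distE : Fin n → Fin n × Fin n → ℕ
  distE x e = dist x (proj₁ e) ⊓ dist x (proj₂ e)

  mcount : Fin n → Fin n → ℕ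
  mcount g h = length (filterᵇ (λ e → distE g e <ᵇ distE h e) edges)

  IsEQDB : ℚ → Set
  IsEQDB λ' = (1ℚ ℚ.< λ') × Connected ×
    (∀ g h → T (adj A g h) →
       (((+ mcount g h) ℚ./ 1) ≡ λ' ℚ.* ((+ mcount h g) ℚ./ 1)) ⊎
       (((+ mcount h g) ℚ./ 1) ≡ λ' ℚ.* ((+ mcount g h) ℚ./ 1)))
    where
      open import Data.Sum using (_⊎_)
      1ℚ = ℚ.1ℚ

-- complete bipartite graph K_{m,n}: vertices Fin (m + n), the first m
-- forming one side, the remaining n the other side.
open import Data.Nat using (_+_)
import Relation.Binary.PropositionalEquality
open import Data.Bool.Properties using (∧-comm)

side : ∀ {k} (m : ℕ) → Fin k → Bool
side m x = toℕ x <ᵇ m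

xor : Bool → Bool → Bool
xor true  b = not b
xor false b = b

xor-comm : ∀ a b → xor a b ≡ xor b a
xor-comm true  true  = Relation.Binary.PropositionalEquality.refl
xor-comm true  false = Relation.Binary.PropositionalEquality.refl
xor-comm false true  = Relation.Binary.PropositionalEquality.refl
xor-comm false false = Relation.Binary.PropositionalEquality.refl

xor-self : ∀ a → xor a a ≡ false
xor-self true  = Relation.Binary.PropositionalEquality.refl
xor-self false = Relation.Binary.PropositionalEquality.refl

K : ℕ → ℕ → Graph
K m n = record
  { V   = m + n
  ; adj = λ x y → xor (side m x) (side m y)
  ; sym = λ x y → xor-comm (side m x) (side m y)
  ; irr = λ x → xor-self (side m x)
  }

pred-nonZero : ∀ {m} → 2 ≤ m → NonZero (m ∸ 1)
pred-nonZero h = >-nonZero (∸-monoˡ-≤ 1 h)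

{-# OPTIONS --safe #-}
-- In K_{m,n} two distinct vertices are at distance 1 when they lie on different sides and at
-- distance 2 otherwise.  Let gh be an edge with g among the first m vertices; every edge is a
-- pair ab with a among the first m vertices and b among the last n, and the distance from g
-- to ab is 0 if a = g and 1 otherwise, while that from h is 0 if b = h and 1 otherwise.  So the
-- edges closer to g are the ab with a = g, b ≠ h, which number n - 1, the edges closer to h
-- number m - 1, and m_g(gh) = ((n - 1)/(m - 1)) m_h(gh).
module Submission where

open import Defs
open import Data.Nat using (ℕ; _≤_; _<_; _∸_)
open import Data.Integer using (+_)
open import Data.Rational using (_/_)

open import Data.Bool using (Bool; true; false; _∧_; _∨_; not; T; T?; if_then_else_)
open import Data.Bool.ListAction using (any)
open import Data.Bool.Properties
  using (T-≡; T-not-≡; T-∧; T-∨; ⇔→≡; ∧-zeroʳ; ∧-identityʳ; ∧-comm; ∧-commutativeMonoid; not-involutive)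
open import Data.Empty using (⊥-elim)
open import Data.Fin using (Fin; toℕ; zero; suc; fromℕ<)
open import Data.Fin.Properties using (toℕ-injective; toℕ-fromℕ<; toℕ<n)
open import Data.List using (List; []; _∷_; _++_; map; length; filterᵇ; tabulate; allFin; cartesianProduct)
open import Data.List.Membership.Propositional using (lose)
open import Data.List.Membership.Propositional.Properties using (∈-allFin)
open import Data.List.Properties using (filter-++; length-++; filter-≐)
open import Data.List.Relation.Unary.Any using (satisfied)
open import Data.List.Relation.Unary.Any.Properties using (any⁺; any⁻)
open import Data.Nat using (zero; suc; _+_; _*_; _⊓_; _<ᵇ_; _≡ᵇ_; z≤n; s≤s)
open import Data.Nat.Properties
  using ( +-suc; *-identityˡ; *-identityʳ; ⊓-comm; ≡ᵇ⇒≡; ≡⇒≡ᵇ; <ᵇ⇒<; <⇒<ᵇ; ≮⇒≥; <⇒≱; <⇒≤; <-≤-trans; ≤-refl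
        ; +-mono-≤; m<m+n; m∸n+n≡m)
import Data.Integer as ℤ
import Data.Integer.Properties as ℤ
open import Data.Rational using (1ℚ; toℚᵘ) renaming (_<_ to _<ℚ_; _*_ to _*ℚ_)
open import Data.Rational.Properties using (toℚᵘ-injective; toℚᵘ-fromℚᵘ; toℚᵘ-homo-*; toℚᵘ-cancel-<)
open import Data.Rational.Unnormalised as ℚᵘ using (mkℚᵘ; *≡*; *<*)
import Data.Rational.Unnormalised.Properties as ℚᵘ
open import Data.Product using (_×_; _,_; proj₁; proj₂; ∃)
open import Data.Sum using (_⊎_; inj₁; inj₂)
import Data.Sum as Sum
open import Data.Unit using (tt)
open import Function using (_∘_; id; mk⇔; Equivalence)
open import Relation.Binary.PropositionalEquality as ≡
  using (_≡_; refl; cong; cong₂; trans; subst; subst₂; module ≡-Reasoning)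
open import Algebra.Bundles using (CommutativeMonoid)
open import Algebra.Properties.CommutativeSemigroup
  (CommutativeMonoid.commutativeSemigroup ∧-commutativeMonoid) using (interchange)

private variable A B : Set

count : ∀ {k} → (Fin k → Bool) → ℕ
count {zero}  p = 0
count {suc k} p = (if p zero then 1 else 0) + count (p ∘ suc)

count-false : ∀ k → count {k} (λ _ → false) ≡ 0
count-false zero    = refl
count-false (suc k) = count-false k

count-true : ∀ k → count {k} (λ _ → true) ≡ k
count-true zero    = refl
count-true (suc k) = cong suc (count-true k)

count-≡-∧ : ∀ {k} (p : ℕ → Bool) c → c < k → p c ≡ true →
  count {k} (λ i → (c ≡ᵇ toℕ i) ∧ p (toℕ i)) ≡ 1
count-≡-∧ {suc k} p zero    _         p0 rewrite p0 = cong suc (count-false k)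
count-≡-∧ {suc k} p (suc c) (s≤s c<k) pc = count-≡-∧ (p ∘ suc) c c<k pc

suc-count-≢-∧ : ∀ {k} (p : ℕ → Bool) c → c < k → p c ≡ true →
  suc (count {k} (λ i → not (c ≡ᵇ toℕ i) ∧ p (toℕ i))) ≡ count {k} (p ∘ toℕ)
suc-count-≢-∧ {suc k} p zero    _         p0 rewrite p0 = refl
suc-count-≢-∧ {suc k} p (suc c) (s≤s c<k) pc =
  trans (≡.sym (+-suc [p0] _)) (cong (_+_ [p0]) (suc-count-≢-∧ (p ∘ suc) c c<k pc))
  where [p0] = if p 0 then 1 else 0

length-filterᵇ-tabulate : ∀ {k} (p : A → Bool) (f : Fin k → A) →
  length (filterᵇ p (tabulate f)) ≡ count (p ∘ f)
length-filterᵇ-tabulate {k = zero}  p f = refl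
length-filterᵇ-tabulate {k = suc k} p f with p (f zero)
... | true  = cong suc (length-filterᵇ-tabulate p (f ∘ suc))
... | false = length-filterᵇ-tabulate p (f ∘ suc)

filterᵇ-cong : ∀ {p q : A → Bool} → (∀ x → p x ≡ q x) → ∀ xs → filterᵇ p xs ≡ filterᵇ q xs
filterᵇ-cong {p = p} {q} p≗q =
  filter-≐ (T? ∘ p) (T? ∘ q) ((λ {x} → subst T (p≗q x)) , λ {x} → subst T (≡.sym (p≗q x)))

filterᵇ-false : ∀ (xs : List A) → filterᵇ (λ _ → false) xs ≡ []
filterᵇ-false []       = refl
filterᵇ-false (x ∷ xs) = filterᵇ-false xs

filterᵇ-filterᵇ : ∀ (p q : A → Bool) xs → filterᵇ p (filterᵇ q xs) ≡ filterᵇ (λ x → p x ∧ q x) xs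
filterᵇ-filterᵇ p q [] = refl
filterᵇ-filterᵇ p q (x ∷ xs) with q x
... | false rewrite ∧-zeroʳ (p x) = filterᵇ-filterᵇ p q xs
... | true rewrite ∧-identityʳ (p x) with p x
...   | true  = cong (x ∷_) (filterᵇ-filterᵇ p q xs)
...   | false = filterᵇ-filterᵇ p q xs

length-filterᵇ-++ : ∀ (p : A → Bool) xs ys →
  length (filterᵇ p (xs ++ ys)) ≡ length (filterᵇ p xs) + length (filterᵇ p ys)
length-filterᵇ-++ p xs ys = trans (cong length (filter-++ (T? ∘ p) xs ys)) (length-++ (filterᵇ p xs))

length-filterᵇ-map : ∀ (p : B → Bool) (f : A → B) xs →
  length (filterᵇ p (map f xs)) ≡ length (filterᵇ (p ∘ f) xs)
length-filterᵇ-map p f [] = refl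
length-filterᵇ-map p f (x ∷ xs) with p (f x)
... | true  = cong suc (length-filterᵇ-map p f xs)
... | false = length-filterᵇ-map p f xs

length-filterᵇ-cartesianProduct : ∀ (p : A → Bool) (q : B → Bool) xs ys →
  length (filterᵇ (λ e → p (proj₁ e) ∧ q (proj₂ e)) (cartesianProduct xs ys))
    ≡ length (filterᵇ p xs) * length (filterᵇ q ys)
length-filterᵇ-cartesianProduct p q [] ys = refl
length-filterᵇ-cartesianProduct p q (x ∷ xs) ys = begin
    length (filterᵇ r (map (x ,_) ys ++ cartesianProduct xs ys))
  ≡⟨ length-filterᵇ-++ r (map (x ,_) ys) _ ⟩
    length (filterᵇ r (map (x ,_) ys)) + length (filterᵇ r (cartesianProduct xs ys))
  ≡⟨ cong₂ _+_ (length-filterᵇ-map r (x ,_) ys) (length-filterᵇ-cartesianProduct p q xs ys) ⟩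
    length (filterᵇ (λ y → p x ∧ q y) ys) + length (filterᵇ p xs) * length (filterᵇ q ys)
  ≡⟨ row (p x) refl ⟩
    length (filterᵇ p (x ∷ xs)) * length (filterᵇ q ys)
  ∎
  where
  open ≡-Reasoning
  r : _ × _ → Bool
  r e = p (proj₁ e) ∧ q (proj₂ e)
  row : ∀ b → p x ≡ b →
    length (filterᵇ (λ y → p x ∧ q y) ys) + length (filterᵇ p xs) * length (filterᵇ q ys)
      ≡ length (filterᵇ p (x ∷ xs)) * length (filterᵇ q ys)
  row true  px rewrite px = refl
  row false px rewrite px =
    cong (λ l → length l + length (filterᵇ p xs) * length (filterᵇ q ys)) (filterᵇ-false ys)

any-allFin : ∀ {k} (p : Fin k → Bool) x → T (p x) → T (any p (allFin k))
any-allFin p x px = any⁺ p (lose (∈-allFin x) px)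

if-true : ∀ {b} {A : Set} {x y : A} → T b → (if b then x else y) ≡ x
if-true {true} _ = refl

<ᵇ-true : ∀ {a b} → a < b → (a <ᵇ b) ≡ true
<ᵇ-true a<b = Equivalence.to T-≡ (<⇒<ᵇ a<b)

<ᵇ-false : ∀ {a b} → b ≤ a → (a <ᵇ b) ≡ false
<ᵇ-false {a} {b} b≤a with a <ᵇ b in a<b
... | false = refl
... | true  = ⊥-elim (<⇒≱ (<ᵇ⇒< a b (Equivalence.from T-≡ a<b)) b≤a)

xor≡false⇒≡ : ∀ {a b} → xor a b ≡ false → a ≡ b
xor≡false⇒≡ {true}  {true}  _ = refl
xor≡false⇒≡ {false} {false} _ = refl

∧-congʳ-if : ∀ {b c d} → (T b → c ≡ d) → c ∧ b ≡ d ∧ b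
∧-congʳ-if {true}          c≡d = cong (_∧ true) (c≡d tt)
∧-congʳ-if {false} {c} {d} _   = trans (∧-zeroʳ c) (≡.sym (∧-zeroʳ d))

if-0-1-<ᵇ : ∀ u v → ((if u then 0 else 1) <ᵇ (if v then 0 else 1)) ≡ u ∧ not v
if-0-1-<ᵇ true  true  = refl
if-0-1-<ᵇ true  false = refl
if-0-1-<ᵇ false true  = refl
if-0-1-<ᵇ false false = refl

module _ (A : Graph) where

  reach-refl : ∀ x → T (reach A 0 x x)
  reach-refl x = ≡⇒≡ᵇ (toℕ x) (toℕ x) refl

  reach-suc : ∀ {k x y} → T (reach A k x y) → T (reach A (suc k) x y)
  reach-suc r = Equivalence.from T-∨ (inj₁ r)

  reach-step : ∀ {k x y} z → T (reach A k x z) → T (adj A z y) → T (reach A (suc k) x y)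
  reach-step {k} {x} {y} z xz zy =
    Equivalence.from T-∨ (inj₂ (any-allFin (λ w → reach A k x w ∧ adj A w y) z
                                           (Equivalence.from T-∧ (xz , zy))))

  reach-adj : ∀ {x y} → T (adj A x y) → T (reach A 1 x y)
  reach-adj {x} = reach-step {0} {x} x (reach-refl x)

  reach-+ : ∀ j {k x y} → T (reach A k x y) → T (reach A (j + k) x y)
  reach-+ zero    r = r
  reach-+ (suc j) {k} r = reach-suc {j + k} (reach-+ j r)

  reach-mono : ∀ {k l x y} → k ≤ l → T (reach A k x y) → T (reach A l x y)
  reach-mono {k} {l} {x} {y} k≤l r = subst (λ j → T (reach A j x y)) (m∸n+n≡m k≤l) (reach-+ (l ∸ k) r)

  reach-1 : ∀ x y → reach A 1 x y ≡ (toℕ x ≡ᵇ toℕ y) ∨ adj A x y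
  reach-1 x y = cong ((toℕ x ≡ᵇ toℕ y) ∨_) (⇔→≡ (mk⇔ to from))
    where
    to : any (λ z → (toℕ x ≡ᵇ toℕ z) ∧ adj A z y) (allFin (V A)) ≡ true → adj A x y ≡ true
    to h with satisfied (any⁻ _ (allFin (V A)) (Equivalence.from T-≡ h))
    ... | z , xz∧zy with Equivalence.to T-∧ xz∧zy
    ...   | xz , zy rewrite toℕ-injective (≡ᵇ⇒≡ (toℕ x) (toℕ z) xz) = Equivalence.to T-≡ zy
    from : adj A x y ≡ true → any (λ z → (toℕ x ≡ᵇ toℕ z) ∧ adj A z y) (allFin (V A)) ≡ true
    from h = Equivalence.to T-≡
      (any-allFin _ x (Equivalence.from T-∧ (reach-refl x , Equivalence.from T-≡ h)))

  adj⇒≢ᵇ : ∀ {x y} → T (adj A x y) → (toℕ x ≡ᵇ toℕ y) ≡ false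
  adj⇒≢ᵇ {x} {y} xy with toℕ x ≡ᵇ toℕ y in x≡y
  ... | false = refl
  ... | true with toℕ-injective (≡ᵇ⇒≡ (toℕ x) (toℕ y) (Equivalence.from T-≡ x≡y))
  ...   | refl = ⊥-elim (subst T (irr A x) xy)

distance-cases : ∀ {r0 r1 a : Bool} {j : ℕ} → r1 ≡ r0 ∨ a → (a ≡ false → j ≡ 2) →
  (if r0 then 0 else if r1 then 1 else j) ≡ (if r0 then 0 else if a then 1 else 2)
distance-cases {true}                refl j≡2 = refl
distance-cases {false} {a = true}  refl j≡2 = refl
distance-cases {false} {a = false} refl j≡2 = j≡2 refl

-- `dist` tries k = 0, 1, … with fuel `V A` and returns the current k once the fuel runs out,
-- so on two vertices it already answers 2 without consulting `reach`.
dist-of-reach-2 : ∀ (A : Graph) x y → T (reach A 2 x y) →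
  dist A x y ≡ (if toℕ x ≡ᵇ toℕ y then 0 else if adj A x y then 1 else 2)
dist-of-reach-2 record { V = suc zero } zero zero _ = refl
dist-of-reach-2 A@record { V = suc (suc zero) } x y _ =
  distance-cases {toℕ x ≡ᵇ toℕ y} {a = adj A x y} (reach-1 A x y) (λ _ → refl)
dist-of-reach-2 A@record { V = suc (suc (suc _)) } x y r2 =
  distance-cases {toℕ x ≡ᵇ toℕ y} {a = adj A x y} (reach-1 A x y) (λ _ → if-true r2)

dist-adj : ∀ (A : Graph) {x y} → T (adj A x y) → dist A x y ≡ 1
dist-adj A {x} {y} xy = begin
    dist A x y
  ≡⟨ dist-of-reach-2 A x y (reach-suc A {1} {x} (reach-adj A xy)) ⟩
    (if toℕ x ≡ᵇ toℕ y then 0 else if adj A x y then 1 else 2)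
  ≡⟨ cong (λ b → if b then 0 else if adj A x y then 1 else 2) (adj⇒≢ᵇ A xy) ⟩
    (if adj A x y then 1 else 2)
  ≡⟨ if-true xy ⟩
    1
  ∎
  where open ≡-Reasoning

count-side : ∀ m n → count {m + n} (side m) ≡ m
count-side zero    n = count-false n
count-side (suc m) n = cong suc (count-side m n)

count-not-side : ∀ m n → count {m + n} (not ∘ side m) ≡ n
count-not-side zero    n = count-true n
count-not-side (suc m) n = count-not-side m n

mcount-product : ∀ (A : Graph) x y (P Q : Fin (V A) → Bool) →
  (∀ a b → (distE A x (a , b) <ᵇ distE A y (a , b)) ∧ ((toℕ a <ᵇ toℕ b) ∧ adj A a b) ≡ P a ∧ Q b) →
  mcount A x y ≡ count P * count Q
mcount-product A x y P Q closer∧edge≡ = begin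
    length (filterᵇ closer (filterᵇ isEdge pairs))
  ≡⟨ cong length (filterᵇ-filterᵇ closer isEdge pairs) ⟩
    length (filterᵇ (λ e → closer e ∧ isEdge e) pairs)
  ≡⟨ cong length (filterᵇ-cong (λ e → closer∧edge≡ (proj₁ e) (proj₂ e)) pairs) ⟩
    length (filterᵇ (λ e → P (proj₁ e) ∧ Q (proj₂ e)) pairs)
  ≡⟨ length-filterᵇ-cartesianProduct P Q vertices vertices ⟩
    length (filterᵇ P vertices) * length (filterᵇ Q vertices)
  ≡⟨ cong₂ _*_ (length-filterᵇ-tabulate P id) (length-filterᵇ-tabulate Q id) ⟩
    count P * count Q
  ∎
  where
  open ≡-Reasoning
  vertices = allFin (V A)
  pairs = cartesianProduct vertices vertices
  closer isEdge : Fin (V A) × Fin (V A) → Bool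
  closer e = distE A x e <ᵇ distE A y e
  isEdge e = (toℕ (proj₁ e) <ᵇ toℕ (proj₂ e)) ∧ adj A (proj₁ e) (proj₂ e)

module Bipartite (m n : ℕ) where

  private G = K m n

  side-true⇒< : ∀ {x : Fin (m + n)} → side m x ≡ true → toℕ x < m
  side-true⇒< {x} x∈A = <ᵇ⇒< (toℕ x) m (Equivalence.from T-≡ x∈A)

  side-false⇒≥ : ∀ {x : Fin (m + n)} → side m x ≡ false → m ≤ toℕ x
  side-false⇒≥ x∈B = ≮⇒≥ (λ x<m → subst T x∈B (<⇒<ᵇ x<m))

  adj-opposite : ∀ {x y} → side m x ≡ not (side m y) → T (adj G x y)
  adj-opposite {x} {y} x≁y rewrite x≁y with side m y
  ... | true  = tt
  ... | false = tt

  vertex-on-side : 0 < m → 0 < n → ∀ s → ∃ λ (z : Fin (m + n)) → side m z ≡ s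
  vertex-on-side (s≤s z≤n) _   true  = zero , refl
  vertex-on-side _         0<n false =
    fromℕ< (m<m+n m 0<n) , trans (cong (_<ᵇ m) (toℕ-fromℕ< (m<m+n m 0<n))) (<ᵇ-false {m} ≤-refl)

  edge-pair : ∀ (a b : Fin (m + n)) → (toℕ a <ᵇ toℕ b) ∧ adj G a b ≡ side m a ∧ not (side m b)
  edge-pair a b with side m a in a∈ | side m b in b∈
  ... | true  | false
    rewrite <ᵇ-true {toℕ a} {toℕ b} (<-≤-trans (side-true⇒< a∈) (side-false⇒≥ b∈)) = refl
  ... | false | true
    rewrite <ᵇ-false {toℕ a} {toℕ b} (<⇒≤ (<-≤-trans (side-true⇒< b∈) (side-false⇒≥ a∈))) = refl
  ... | true  | true  = ∧-zeroʳ _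
  ... | false | false = ∧-zeroʳ _

  module _ (0<m : 0 < m) (0<n : 0 < n) where

    diameter-2 : ∀ x y → T (reach G 2 x y)
    diameter-2 x y with xor (side m x) (side m y) in x~y
    ... | true  = reach-suc G {1} {x} (reach-adj G (Equivalence.from T-≡ x~y))
    ... | false with vertex-on-side 0<m 0<n (not (side m y))
    ...   | z , z∈ = reach-step G {1} {x} z (reach-adj G (adj-opposite x≁z)) (adj-opposite z∈)
      where
      x≁z : side m x ≡ not (side m z)
      x≁z = trans (xor≡false⇒≡ x~y) (trans (≡.sym (not-involutive _)) (cong not (≡.sym z∈)))

    connected : Connected G
    connected x y = reach-mono G (+-mono-≤ 0<m 0<n) (diameter-2 x y)

    dist-same-side : ∀ {x y} → side m x ≡ side m y → dist G x y ≡ (if toℕ x ≡ᵇ toℕ y then 0 else 2)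
    dist-same-side {x} {y} x∼y = trans (dist-of-reach-2 G x y (diameter-2 x y))
      (cong (λ b → if toℕ x ≡ᵇ toℕ y then 0 else if b then 1 else 2)
            (trans (cong (λ s → xor s (side m y)) x∼y) (xor-self (side m y))))

    distE-adjacent : ∀ {x y z} → side m x ≡ side m y → T (adj G x z) →
      dist G x y ⊓ dist G x z ≡ (if toℕ x ≡ᵇ toℕ y then 0 else 1)
    distE-adjacent {x} {y} x∼y x~z rewrite dist-same-side x∼y | dist-adj G x~z with toℕ x ≡ᵇ toℕ y
    ... | true  = refl
    ... | false = refl

    module _ {g h : Fin (m + n)} (g∈A : side m g ≡ true) (h∈B : side m h ≡ false) where

      distE-left : ∀ {a b} → side m a ≡ true → side m b ≡ false →
        distE G g (a , b) ≡ (if toℕ g ≡ᵇ toℕ a then 0 else 1)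
      distE-left a∈A b∈B =
        distE-adjacent (trans g∈A (≡.sym a∈A)) (adj-opposite (trans g∈A (cong not (≡.sym b∈B))))

      distE-right : ∀ {a b} → side m a ≡ true → side m b ≡ false →
        distE G h (a , b) ≡ (if toℕ h ≡ᵇ toℕ b then 0 else 1)
      distE-right a∈A b∈B = trans (⊓-comm _ _)
        (distE-adjacent (trans h∈B (≡.sym b∈B)) (adj-opposite (trans h∈B (cong not (≡.sym a∈A)))))

      edge-closer : ∀ (f : ℕ → ℕ → Bool) a b →
        f (distE G g (a , b)) (distE G h (a , b)) ∧ ((toℕ a <ᵇ toℕ b) ∧ adj G a b)
          ≡ f (if toℕ g ≡ᵇ toℕ a then 0 else 1) (if toℕ h ≡ᵇ toℕ b then 0 else 1) ∧ (side m a ∧ not (side m b))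
      edge-closer f a b =
        trans (cong (f (distE G g (a , b)) (distE G h (a , b)) ∧_) (edge-pair a b)) (∧-congʳ-if on-edge)
        where
        on-edge : T (side m a ∧ not (side m b)) →
          f (distE G g (a , b)) (distE G h (a , b))
            ≡ f (if toℕ g ≡ᵇ toℕ a then 0 else 1) (if toℕ h ≡ᵇ toℕ b then 0 else 1)
        on-edge ab =
          let a∈A , b∈B = Equivalence.to T-∧ ab
              a∈A′ = Equivalence.to T-≡ a∈A
              b∈B′ = Equivalence.to T-not-≡ b∈B
          in cong₂ f (distE-left a∈A′ b∈B′) (distE-right a∈A′ b∈B′)

      closer-left : ∀ a b →
        (distE G g (a , b) <ᵇ distE G h (a , b)) ∧ ((toℕ a <ᵇ toℕ b) ∧ adj G a b)
          ≡ ((toℕ g ≡ᵇ toℕ a) ∧ side m a) ∧ (not (toℕ h ≡ᵇ toℕ b) ∧ not (side m b))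
      closer-left a b = trans (edge-closer _<ᵇ_ a b)
        (trans (cong (_∧ (side m a ∧ not (side m b))) (if-0-1-<ᵇ (toℕ g ≡ᵇ toℕ a) (toℕ h ≡ᵇ toℕ b)))
               (interchange (toℕ g ≡ᵇ toℕ a) (not (toℕ h ≡ᵇ toℕ b)) (side m a) (not (side m b))))

      closer-right : ∀ a b →
        (distE G h (a , b) <ᵇ distE G g (a , b)) ∧ ((toℕ a <ᵇ toℕ b) ∧ adj G a b)
          ≡ (not (toℕ g ≡ᵇ toℕ a) ∧ side m a) ∧ ((toℕ h ≡ᵇ toℕ b) ∧ not (side m b))
      closer-right a b = trans (edge-closer (λ dg dh → dh <ᵇ dg) a b)
        (trans (cong (_∧ (side m a ∧ not (side m b)))
                     (trans (if-0-1-<ᵇ (toℕ h ≡ᵇ toℕ b) (toℕ g ≡ᵇ toℕ a)) (∧-comm (toℕ h ≡ᵇ toℕ b) _)))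
               (interchange (not (toℕ g ≡ᵇ toℕ a)) (toℕ h ≡ᵇ toℕ b) (side m a) (not (side m b))))

      mcount-left : mcount G g h ≡ n ∸ 1
      mcount-left = begin
          mcount G g h
        ≡⟨ mcount-product G g h (λ a → (toℕ g ≡ᵇ toℕ a) ∧ side m a)
                                (λ b → not (toℕ h ≡ᵇ toℕ b) ∧ not (side m b)) closer-left ⟩
          count {m + n} (λ a → (toℕ g ≡ᵇ toℕ a) ∧ side m a)
            * count {m + n} (λ b → not (toℕ h ≡ᵇ toℕ b) ∧ not (side m b))
        ≡⟨ cong₂ _*_ (count-≡-∧ (_<ᵇ m) (toℕ g) (toℕ<n g) g∈A)
                     (cong (_∸ 1) (trans (suc-count-≢-∧ (not ∘ (_<ᵇ m)) (toℕ h) (toℕ<n h) (cong not h∈B))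
                                         (count-not-side m n))) ⟩
          1 * (n ∸ 1)
        ≡⟨ *-identityˡ (n ∸ 1) ⟩
          n ∸ 1
        ∎
        where open ≡-Reasoning

      mcount-right : mcount G h g ≡ m ∸ 1
      mcount-right = begin
          mcount G h g
        ≡⟨ mcount-product G h g (λ a → not (toℕ g ≡ᵇ toℕ a) ∧ side m a)
                                (λ b → (toℕ h ≡ᵇ toℕ b) ∧ not (side m b)) closer-right ⟩
          count {m + n} (λ a → not (toℕ g ≡ᵇ toℕ a) ∧ side m a)
            * count {m + n} (λ b → (toℕ h ≡ᵇ toℕ b) ∧ not (side m b))
        ≡⟨ cong₂ _*_ (cong (_∸ 1) (trans (suc-count-≢-∧ (_<ᵇ m) (toℕ g) (toℕ<n g) g∈A) (count-side m n)))
                     (count-≡-∧ (not ∘ (_<ᵇ m)) (toℕ h) (toℕ<n h) (cong not h∈B)) ⟩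
          (m ∸ 1) * 1
        ≡⟨ *-identityʳ (m ∸ 1) ⟩
          m ∸ 1
        ∎
        where open ≡-Reasoning

    edge-mcounts : ∀ g h → T (adj G g h) →
      (mcount G g h ≡ n ∸ 1 × mcount G h g ≡ m ∸ 1) ⊎ (mcount G h g ≡ n ∸ 1 × mcount G g h ≡ m ∸ 1)
    edge-mcounts g h with side m g in g∈ | side m h in h∈
    ... | true  | false = λ _ → inj₁ (mcount-left g∈ h∈ , mcount-right g∈ h∈)
    ... | false | true  = λ _ → inj₂ (mcount-left h∈ g∈ , mcount-right h∈ g∈)
    ... | true  | true  = λ ()
    ... | false | false = λ ()

a/d*d≡a : ∀ a d → ((+ a) / suc d) *ℚ ((+ suc d) / 1) ≡ (+ a) / 1
a/d*d≡a a d = toℚᵘ-injective (begin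
    toℚᵘ (((+ a) / suc d) *ℚ ((+ suc d) / 1))
  ≈⟨ toℚᵘ-homo-* ((+ a) / suc d) ((+ suc d) / 1) ⟩
    toℚᵘ ((+ a) / suc d) ℚᵘ.* toℚᵘ ((+ suc d) / 1)
  ≈⟨ ℚᵘ.*-cong (toℚᵘ-fromℚᵘ (mkℚᵘ (+ a) d)) (toℚᵘ-fromℚᵘ (mkℚᵘ (+ suc d) 0)) ⟩
    mkℚᵘ (+ a) d ℚᵘ.* mkℚᵘ (+ suc d) 0
  ≈⟨ *≡* (trans (ℤ.*-identityʳ _) (cong (λ k → + a ℤ.* + k) (≡.sym (*-identityʳ (suc d))))) ⟩
    mkℚᵘ (+ a) 0
  ≈⟨ ℚᵘ.≃-sym (toℚᵘ-fromℚᵘ (mkℚᵘ (+ a) 0)) ⟩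
    toℚᵘ ((+ a) / 1)
  ∎)
  where open ℚᵘ.≃-Reasoning

1<a/d : ∀ {a d} → suc d < a → 1ℚ <ℚ (+ a) / suc d
1<a/d {a} {d} d<a = toℚᵘ-cancel-< (ℚᵘ.<-respʳ-≃ (ℚᵘ.≃-sym (toℚᵘ-fromℚᵘ (mkℚᵘ (+ a) d)))
  (*<* (subst₂ ℤ._<_ (≡.sym (ℤ.*-identityˡ (+ suc d))) (≡.sym (ℤ.*-identityʳ (+ a))) (ℤ.+<+ d<a))))

corollary2p1 : (m n : ℕ) (2≤m : 2 ≤ m) → m < n →
    IsEQDB (K m n) (_/_ (+ (n ∸ 1)) (m ∸ 1) {{pred-nonZero 2≤m}})
corollary2p1 m@(suc (suc m')) n@(suc n') (s≤s (s≤s z≤n)) (s≤s m<n) =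
  1<a/d m<n , connected 0<m 0<n , λ g h g~h → Sum.map ratio ratio (edge-mcounts 0<m 0<n g h g~h)
  where
  open Bipartite m n
  0<m : 0 < m
  0<m = s≤s z≤n
  0<n : 0 < n
  0<n = s≤s z≤n
  ratio : ∀ {p q} → p ≡ n' × q ≡ suc m' → (+ p) / 1 ≡ ((+ n') / suc m') *ℚ ((+ q) / 1)
  ratio (refl , refl) = ≡.sym (a/d*d≡a n' m')
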